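{- Let $k\ge1$, let $w$ be a bi-infinite word over $\Sigma_k$, and let $m:\Sigma_3^*\to\Sigma_k^*$ be a morphism such that (i) $w\in\{m(\texttt{0}),m(\texttt{1}),m(\texttt{2})\}^\omega$, i.e. $w$ is a bi-infinite concatenation of these three words; (ii) $m(\texttt{0})=abxb$, $m(\texttt{1})=ab$ and $m(\texttt{2})=ay$, where $a$ and $b$ are letters and $x$ and $y$ are possibly empty words; (iii) $w$ is overlap-free. Then $w$ has the same set of finite factors as $m(b_3)$.
   Context: $\Sigma_k=\{\texttt{0},\dots,\texttt{k-1}\}$. A word is overlap-free if it contains no factor of the form $u^nv$ with $u$ nonempty, $v$ a prefix of $u$, and $|u^nv|/|u|>2$ (equivalently no factor $cucuc$ with $c$ a letter). $b_3$ is the Hall–Thue word, the fixed point starting with $\texttt{0}$ of the morphism $\texttt{0}\mapsto\texttt{012}$, $\texttt{1}\mapsto\texttt{02}$, $\texttt{2}\mapsto\texttt{1}$. -}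

module Defs where

open import Data.Nat using (ℕ; zero; suc)
open import Data.Fin using (Fin; zero; suc)
open import Data.Integer using (ℤ; +_; _+_)
open import Data.List using (List; []; _∷_; _++_; concatMap; length; [_])
open import Data.Product using (Σ; ∃; _×_; _,_)
open import Data.Unit using (⊤)
open import Relation.Binary.PropositionalEquality using (_≡_)
open import Relation.Nullary using (¬_)

Word : ℕ → Set
Word k = List (Fin k)

BiWord : ℕ → Set
BiWord k = ℤ → Fin k

OccursAt : {k : ℕ} → BiWord k → ℤ → Word k → Set
OccursAt w z []      = ⊤
OccursAt w z (c ∷ v) = w z ≡ c × OccursAt w (+ 1 + z) v

BiFactor : {k : ℕ} → BiWord k → Word k → Set
BiFactor w v = ∃ λ z → OccursAt w z v

FinFactor : {A : Set} → List A → List A → Set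
FinFactor {A} v u = Σ (List A) λ p → Σ (List A) λ s → p ++ v ++ s ≡ u

OverlapFree : {k : ℕ} → BiWord k → Set
OverlapFree {k} w = (c : Fin k) (u : Word k) → ¬ BiFactor w (c ∷ u ++ c ∷ u ++ [ c ])

Morphism3 : ℕ → Set
Morphism3 k = Fin 3 → Word k

applyM : {k : ℕ} → Morphism3 k → Word 3 → Word k
applyM m = concatMap m

BiConcat : {k : ℕ} → BiWord k → Morphism3 k → Set
BiConcat w m = Σ (ℤ → Fin 3) λ s → Σ (ℤ → ℤ) λ p →
  ((i : ℤ) → p (+ 1 + i) ≡ p i + + length (m (s i))) ×
  ((i : ℤ) → OccursAt w (p i) (m (s i)))

-- The Hall–Thue morphism 0 ↦ 012, 1 ↦ 02, 2 ↦ 1.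
φ3 : Morphism3 3
φ3 zero             = zero ∷ suc zero ∷ suc (suc zero) ∷ []
φ3 (suc zero)       = zero ∷ suc (suc zero) ∷ []
φ3 (suc (suc zero)) = suc zero ∷ []

-- φ3ⁿ(0): these are the successive prefixes of b₃ (the fixed point starting with 0).
b3prefix : ℕ → Word 3
b3prefix zero    = zero ∷ []
b3prefix (suc n) = applyM φ3 (b3prefix n)

-- v is a finite factor of the infinite word m(b₃) = lim m(φ3ⁿ(0)).
FactorOfMb3 : {k : ℕ} → Morphism3 k → Word k → Set
FactorOfMb3 m v = ∃ λ n → FinFactor v (applyM m (b3prefix n))

{-# OPTIONS --safe #-}
-- Write w = m(s) with s a bi-infinite word over Σ₃.  Every image m(c) starts with a, so a square
-- (cu)(cu) in s followed by any letter maps to an overlap aRaRa in w; the images of 010 and 02120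
-- contain the overlaps babab and b(aya)b(aya)b, and every other extension of 212 contains a square.
-- So s is admissible (square-free, avoiding 010 and 212), and by Thue such bi-infinite words have the
-- same factors as b₃.  For the latter, an admissible word desubstitutes as αφ(t)β with t admissible and
-- α, β short; iterating, a factor lying deep inside an admissible word is covered by φᴺ of a factor
-- of length ≤ 2, hence is a factor of b₃, while every long admissible word contains φⁿ(0).
module Submission where

open import Defs
open import Data.Nat using (ℕ; zero; suc; _+_; _*_; _^_; _≤_; _<_; z≤n; s≤s; _≤?_)
open import Data.Nat.Properties
  using (≤-refl; ≤-trans; ≤-reflexive; ≤-pred; <⇒≤; <⇒≱; ≰⇒>; m≤n⇒m≤1+n; m≤n⇒m≤o+n;
         +-comm; +-assoc; +-identityʳ; +-mono-≤; +-monoʳ-≤; +-cancelʳ-≤; *-suc; *-assoc; *-monoʳ-≤;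
         module ≤-Reasoning)
open import Data.Fin using (Fin; zero; suc)
open import Data.Integer as ℤ using (ℤ; +_; -[1+_])
import Data.Integer.Properties as ℤ
open import Data.List using (List; []; _∷_; _++_; [_]; length; concatMap; initLast; _∷ʳ′_)
open import Data.List.Properties using (++-assoc; ++-identityʳ; ++-monoid; length-++; concatMap-++; ∷-injective)
open import Data.Product using (Σ; ∃; ∃₂; _×_; _,_)
open import Data.Sum using (_⊎_; inj₁; inj₂)
open import Data.Empty using (⊥-elim)
open import Data.Unit using (tt)
open import Function.Base using (_∘_)
open import Function.Bundles using (_⇔_; mk⇔)
open import Relation.Binary.PropositionalEquality hiding ([_])
open import Relation.Nullary using (¬_; yes; no)
import Algebra.Solver.Monoid

module ++-Solver {A : Set} = Algebra.Solver.Monoid (++-monoid A)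
open ++-Solver using (solve; _⊕_; _⊜_; id)

module _ {A : Set} where

  FinFactor-refl : (u : List A) → FinFactor u u
  FinFactor-refl u = [] , [] , ++-identityʳ u

  FinFactor-trans : {u v w : List A} → FinFactor u v → FinFactor v w → FinFactor u w
  FinFactor-trans {u} (p , q , refl) (p′ , q′ , refl) =
    p′ ++ p , q ++ q′ ,
    solve 5 (λ p′ p u q q′ → (p′ ⊕ p) ⊕ u ⊕ q ⊕ q′ ⊜ p′ ⊕ (p ⊕ u ⊕ q) ⊕ q′) refl p′ p u q q′

  FinFactor-∷ : {u v : List A} (c : A) → FinFactor u v → FinFactor u (c ∷ v)
  FinFactor-∷ c (p , q , eq) = c ∷ p , q , cong (c ∷_) eq

  ¬FinFactor-[] : {c : A} {u : List A} → ¬ FinFactor (c ∷ u) []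
  ¬FinFactor-[] ([] , _ , ())
  ¬FinFactor-[] (_ ∷ _ , _ , ())

  FinFactor-widenˡ : {u v : List A} (c : A) → FinFactor u v → ∃ λ e → FinFactor (e ∷ u) (c ∷ v)
  FinFactor-widenˡ c ([] , q , refl) = c , [] , q , refl
  FinFactor-widenˡ c (c′ ∷ p , q , refl) with FinFactor-widenˡ c′ (p , q , refl)
  ... | e , F = e , FinFactor-∷ c F

  FinFactor-widenʳ : {u v : List A} (d : A) → FinFactor u v → ∃ λ f → FinFactor (u ++ [ f ]) (v ++ [ d ])
  FinFactor-widenʳ {u} d (p , [] , refl) =
    d , p , [] , solve 3 (λ p u d → p ⊕ (u ⊕ d) ⊕ id ⊜ (p ⊕ u ⊕ id) ⊕ d) refl p u [ d ]
  FinFactor-widenʳ {u} d (p , f ∷ q , refl) =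
    f , p , q ++ [ d ] ,
    solve 5 (λ p u f q d → p ⊕ (u ⊕ f) ⊕ q ⊕ d ⊜ (p ⊕ u ⊕ f ⊕ q) ⊕ d) refl p u [ f ] q [ d ]

  length-++-≤ : (u : List A) {v : List A} {a b : ℕ} → length u ≤ a → length v ≤ b → length (u ++ v) ≤ a + b
  length-++-≤ u u≤a v≤b = ≤-trans (≤-reflexive (length-++ u)) (+-mono-≤ u≤a v≤b)

  levi : (u v u′ v′ : List A) → u ++ v ≡ u′ ++ v′ → length u′ ≤ length u →
         ∃ λ e → u ≡ u′ ++ e × v′ ≡ e ++ v
  levi u v [] v′ eq _ = u , refl , sym eq
  levi (c ∷ u) v (c′ ∷ u′) v′ eq (s≤s le) with ∷-injective eq
  ... | refl , eq′ with levi u v u′ v′ eq′ le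
  ... | e , refl , refl = e , refl , refl

  FinFactor-inner : (p u q α M β : List A) → p ++ u ++ q ≡ α ++ M ++ β →
                    length α ≤ length p → length β ≤ length q → FinFactor u M
  FinFactor-inner p u q α M β eq α≤p β≤q with levi p (u ++ q) α (M ++ β) eq α≤p
  ... | e , refl , eq′ with levi M β (e ++ u) q M≡ eu≤M
    where
    M≡ : M ++ β ≡ (e ++ u) ++ q
    M≡ = trans eq′ (sym (++-assoc e u q))
    eu≤M : length (e ++ u) ≤ length M
    eu≤M = +-cancelʳ-≤ (length q) (length (e ++ u)) (length M) (begin
      length (e ++ u) + length q   ≡⟨ length-++ (e ++ u) ⟨
      length ((e ++ u) ++ q)       ≡⟨ cong length M≡ ⟨
      length (M ++ β)              ≡⟨ length-++ M ⟩
      length M + length β          ≤⟨ +-monoʳ-≤ (length M) β≤q ⟩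
      length M + length q          ∎)
      where open ≤-Reasoning
  ... | e′ , refl , _ = e , e′ , sym (++-assoc e u e′)

module _ {A B : Set} (h : A → List B) where

  FinFactor-concatMap : {u v : List A} → FinFactor u v → FinFactor (concatMap h u) (concatMap h v)
  FinFactor-concatMap {u} (p , q , refl) = concatMap h p , concatMap h q , (begin
    concatMap h p ++ concatMap h u ++ concatMap h q   ≡⟨ cong (concatMap h p ++_) (concatMap-++ h u q) ⟨
    concatMap h p ++ concatMap h (u ++ q)             ≡⟨ concatMap-++ h p (u ++ q) ⟨
    concatMap h (p ++ u ++ q)                         ∎)
    where open ≡-Reasoning

  factor-within-two-images : {u : List B} → (∀ c → length u ≤ length (h c)) → (t : List A) →
    FinFactor u (concatMap h t) → ∃ λ x → length x ≤ 2 × FinFactor x t × FinFactor u (concatMap h x)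
  factor-within-two-images {[]} _ [] F = [] , z≤n , FinFactor-refl [] , F
  factor-within-two-images {_ ∷ _} _ [] F = ⊥-elim (¬FinFactor-[] F)
  factor-within-two-images {u} long (c ∷ t) (p , q , eq) with length (h c) ≤? length p
  ... | yes hc≤p with levi p (u ++ q) (h c) (concatMap h t) eq hc≤p
  ...   | e , refl , eq′ with factor-within-two-images long t (e , q , sym eq′)
  ...     | x , x≤2 , x∈t , u∈hx = x , x≤2 , FinFactor-∷ c x∈t , u∈hx
  factor-within-two-images {u} long (c ∷ []) (p , q , eq) | no _ =
    c ∷ [] , s≤s z≤n , FinFactor-refl (c ∷ []) , p , q , eq
  factor-within-two-images {u} long (c ∷ d ∷ t) (p , q , eq) | no hc≰p
    with levi (h c ++ h d) (concatMap h t) (p ++ u) q eq′ pu≤hchd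
    where
    eq′ : (h c ++ h d) ++ concatMap h t ≡ (p ++ u) ++ q
    eq′ = trans (++-assoc (h c) (h d) _) (trans (sym eq) (sym (++-assoc p u q)))
    pu≤hchd : length (p ++ u) ≤ length (h c ++ h d)
    pu≤hchd = begin
      length (p ++ u)           ≡⟨ length-++ p ⟩
      length p + length u       ≤⟨ +-mono-≤ (<⇒≤ (≰⇒> hc≰p)) (long d) ⟩
      length (h c) + length (h d) ≡⟨ length-++ (h c) ⟨
      length (h c ++ h d)       ∎
      where open ≤-Reasoning
  ... | e , eq″ , _ = c ∷ d ∷ [] , s≤s (s≤s z≤n) , ([] , t , refl) , p , e ,
    trans (sym (++-assoc p u e)) (trans (sym eq″) (cong (h c ++_) (sym (++-identityʳ (h d)))))

suc[i]+n≡i+suc[n] : ∀ i n → ℤ.suc i ℤ.+ + n ≡ i ℤ.+ + suc n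
suc[i]+n≡i+suc[n] i n = trans (cong (ℤ._+ + n) (ℤ.+-comm (+ 1) i)) (ℤ.+-assoc i (+ 1) (+ n))

pred[i+suc[n]]≡i+n : ∀ i n → ℤ.pred (i ℤ.+ + suc n) ≡ i ℤ.+ + n
pred[i+suc[n]]≡i+n i n = trans (sym (ℤ.+-pred i (+ suc n))) (cong (λ v → i ℤ.+ v) (ℤ.pred-suc (+ n)))

i≡j+[i-j] : ∀ i j → i ≡ j ℤ.+ (i ℤ.- j)
i≡j+[i-j] i j = sym (begin
  j ℤ.+ (i ℤ.- j)          ≡⟨ cong (λ v → j ℤ.+ v) (ℤ.+-comm i (ℤ.- j)) ⟩
  j ℤ.+ (ℤ.- j ℤ.+ i)      ≡⟨ ℤ.+-assoc j (ℤ.- j) i ⟨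
  (j ℤ.- j) ℤ.+ i          ≡⟨ cong (ℤ._+ i) (ℤ.+-inverseʳ j) ⟩
  + 0 ℤ.+ i                ≡⟨ ℤ.+-identityˡ i ⟩
  i                        ∎)
  where open ≡-Reasoning

module _ {k : ℕ} (f : BiWord k) where

  OccursAt-++ : ∀ z (u v : Word k) → OccursAt f z u → OccursAt f (z ℤ.+ + length u) v → OccursAt f z (u ++ v)
  OccursAt-++ z []      v _          o = subst (λ z′ → OccursAt f z′ v) (ℤ.+-identityʳ z) o
  OccursAt-++ z (c ∷ u) v (fz , ou) o =
    fz , OccursAt-++ (ℤ.suc z) u v ou (subst (λ z′ → OccursAt f z′ v) (sym (suc[i]+n≡i+suc[n] z (length u))) o)

  OccursAt-++ˡ : ∀ z (u v : Word k) → OccursAt f z (u ++ v) → OccursAt f z u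
  OccursAt-++ˡ z []      v _        = tt
  OccursAt-++ˡ z (c ∷ u) v (fz , o) = fz , OccursAt-++ˡ (ℤ.suc z) u v o

  OccursAt-++ʳ : ∀ z (u v : Word k) → OccursAt f z (u ++ v) → OccursAt f (z ℤ.+ + length u) v
  OccursAt-++ʳ z []      v o        = subst (λ z′ → OccursAt f z′ v) (sym (ℤ.+-identityʳ z)) o
  OccursAt-++ʳ z (c ∷ u) v (_ , o) =
    subst (λ z′ → OccursAt f z′ v) (suc[i]+n≡i+suc[n] z (length u)) (OccursAt-++ʳ (ℤ.suc z) u v o)

  OccursAt-prefix : ∀ z (u v : Word k) → OccursAt f z u → OccursAt f z v → length v ≤ length u →
                    ∃ λ r → u ≡ v ++ r
  OccursAt-prefix z u       []      _         _         _       = u , refl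
  OccursAt-prefix z (c ∷ u) (c′ ∷ v) (fz , ou) (fz′ , ov) (s≤s v≤u)
    with OccursAt-prefix (ℤ.suc z) u v ou ov v≤u
  ... | r , refl = r , cong (_∷ v ++ r) (trans (sym fz) fz′)

  OccursAt-within : ∀ z d (u v : Word k) → OccursAt f z u → OccursAt f (z ℤ.+ + d) v →
                    d + length v ≤ length u → FinFactor v u
  OccursAt-within z zero u v ou ov v≤u
    with OccursAt-prefix z u v ou (subst (λ z′ → OccursAt f z′ v) (ℤ.+-identityʳ z) ov) v≤u
  ... | r , eq = [] , r , sym eq
  OccursAt-within z (suc d) (c ∷ u) v (_ , ou) ov (s≤s dv≤u) =
    FinFactor-∷ c (OccursAt-within (ℤ.suc z) d u v ou
      (subst (λ z′ → OccursAt f z′ v) (sym (suc[i]+n≡i+suc[n] z d)) ov) dv≤u)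

  window : ℤ → ℕ → Word k
  window z zero    = []
  window z (suc n) = f z ∷ window (ℤ.suc z) n

  OccursAt-window : ∀ z n → OccursAt f z (window z n)
  OccursAt-window z zero    = tt
  OccursAt-window z (suc n) = refl , OccursAt-window (ℤ.suc z) n

  length-window : ∀ z n → length (window z n) ≡ n
  length-window z zero    = refl
  length-window z (suc n) = cong suc (length-window (ℤ.suc z) n)

  FinFactor-BiFactor : {u v : Word k} → FinFactor u v → BiFactor f v → BiFactor f u
  FinFactor-BiFactor {u} (p , q , refl) (z , o) =
    z ℤ.+ + length p , OccursAt-++ˡ _ u q (OccursAt-++ʳ z p (u ++ q) o)

  BiFactor-∷ʳ : {u : Word k} → BiFactor f u → ∃ λ c → BiFactor f (u ++ [ c ])
  BiFactor-∷ʳ {u} (z , o) = f (z ℤ.+ + length u) , z , OccursAt-++ z u _ o (refl , tt)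

  BiFactor-∷ : {u : Word k} → BiFactor f u → ∃ λ c → BiFactor f (c ∷ u)
  BiFactor-∷ {u} (z , o) =
    f (ℤ.pred z) , ℤ.pred z , refl , subst (λ z′ → OccursAt f z′ u) (sym (ℤ.suc-pred z)) o

  BiFactor-extendˡ : {u : Word k} → BiFactor f u → ∀ n → ∃ λ pre → length pre ≡ n × BiFactor f (pre ++ u)
  BiFactor-extendˡ F zero = [] , refl , F
  BiFactor-extendˡ F (suc n) with BiFactor-extendˡ F n
  ... | pre , refl , F′ with BiFactor-∷ F′
  ... | c , F″ = c ∷ pre , refl , F″

  BiFactor-extendʳ : {u : Word k} → BiFactor f u → ∀ n → ∃ λ suf → length suf ≡ n × BiFactor f (u ++ suf)
  BiFactor-extendʳ {u} (z , o) n =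
    window (z ℤ.+ + length u) n , length-window _ n , z , OccursAt-++ z u _ o (OccursAt-window _ n)

  BiFactor-bordered : {u : Word k} → BiFactor f u → ∀ n →
                      ∃₂ λ pre suf → length pre ≡ n × length suf ≡ n × BiFactor f (pre ++ u ++ suf)
  BiFactor-bordered F n with BiFactor-extendʳ F n
  ... | suf , |suf|≡n , F′ with BiFactor-extendˡ F′ n
  ... | pre , |pre|≡n , F″ = pre , suf , |pre|≡n , |suf|≡n , F″

SquareFree : {A : Set} → List A → Set
SquareFree z = ∀ c u → ¬ FinFactor (c ∷ u ++ c ∷ u) z

SquareFree-factor : {A : Set} {u v : List A} → FinFactor u v → SquareFree v → SquareFree u
SquareFree-factor u∈v sf c r sq = sf c r (FinFactor-trans sq u∈v)

pattern L0 = zero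
pattern L1 = suc zero
pattern L2 = suc (suc zero)

-- Thue: these are exactly the factors of b₃.
record Admissible (z : Word 3) : Set where
  field
    square-free : SquareFree z
    no-010      : ¬ FinFactor (L0 ∷ L1 ∷ L0 ∷ []) z
    no-212      : ¬ FinFactor (L2 ∷ L1 ∷ L2 ∷ []) z
open Admissible

Admissible-factor : {u v : Word 3} → FinFactor u v → Admissible v → Admissible u
Admissible-factor u∈v adm = record
  { square-free = SquareFree-factor u∈v (square-free adm)
  ; no-010      = λ F → no-010 adm (FinFactor-trans F u∈v)
  ; no-212      = λ F → no-212 adm (FinFactor-trans F u∈v)
  }

Admissible-[] : Admissible []
Admissible-[] = record { square-free = λ _ _ → ¬FinFactor-[] ; no-010 = ¬FinFactor-[] ; no-212 = ¬FinFactor-[] }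

φ : Word 3 → Word 3
φ = applyM φ3

φ^ : ℕ → Word 3 → Word 3
φ^ zero    t = t
φ^ (suc n) t = φ (φ^ n t)

φ-++ : ∀ u v → φ (u ++ v) ≡ φ u ++ φ v
φ-++ = concatMap-++ φ3

φ-∷ : ∀ c u → ∃₂ λ e r → φ (c ∷ u) ≡ e ∷ r
φ-∷ L0 u = _ , _ , refl
φ-∷ L1 u = _ , _ , refl
φ-∷ L2 u = _ , _ , refl

SquareFree-φ⁻¹ : ∀ {t} → SquareFree (φ t) → SquareFree t
SquareFree-φ⁻¹ {t} sf c u sq with φ-∷ c u
... | e , r , eq = sf e r (subst (λ v → FinFactor v (φ t)) φ[cucu]≡erer (FinFactor-concatMap φ3 sq))
  where
  φ[cucu]≡erer : φ (c ∷ u ++ c ∷ u) ≡ e ∷ r ++ e ∷ r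
  φ[cucu]≡erer = trans (φ-++ (c ∷ u) (c ∷ u)) (cong₂ _++_ eq eq)

Admissible-φ⁻¹ : ∀ c t d → Admissible (φ (c ∷ t ++ [ d ])) → Admissible t
Admissible-φ⁻¹ c t d adm = record
  { square-free = SquareFree-factor t∈t₀ sf
  ; no-010      = no-010′
  ; no-212      = no-212′
  }
  where
  t∈t₀ : FinFactor t (c ∷ t ++ [ d ])
  t∈t₀ = c ∷ [] , [ d ] , refl

  sf : SquareFree (c ∷ t ++ [ d ])
  sf = SquareFree-φ⁻¹ (square-free adm)

  -- φ(010) = 01202012 contains (20)².
  no-010′ : ¬ FinFactor (L0 ∷ L1 ∷ L0 ∷ []) t
  no-010′ F = square-free adm L2 (L0 ∷ [])
    (FinFactor-trans (L0 ∷ L1 ∷ [] , L1 ∷ L2 ∷ [] , refl) (FinFactor-concatMap φ3 (FinFactor-trans F t∈t₀)))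

  no-212′ : ¬ FinFactor (L2 ∷ L1 ∷ L2 ∷ []) t
  no-212′ F with FinFactor-widenʳ d F
  ... | f , F′ with FinFactor-widenˡ c F′
  ... | L1 , F″ = sf L1 (L2 ∷ []) (FinFactor-trans ([] , f ∷ [] , refl) F″)
  ... | L2 , F″ = sf L2 [] (FinFactor-trans ([] , L1 ∷ L2 ∷ f ∷ [] , refl) F″)
  ... | L0 , F″ with f
  ...   | L1 = sf L2 (L1 ∷ []) (FinFactor-trans (L0 ∷ [] , [] , refl) F″)
  ...   | L2 = sf L2 [] (FinFactor-trans (L0 ∷ L2 ∷ L1 ∷ [] , [] , refl) F″)
  -- φ(02120) = 0121021012 contains (210)².
  ...   | L0 = square-free adm L2 (L1 ∷ L0 ∷ [])
    (FinFactor-trans (L0 ∷ L1 ∷ [] , L1 ∷ L2 ∷ [] , refl) (FinFactor-concatMap φ3 F″))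

Admissible-suffix : ∀ p {r} → Admissible (p ++ r) → Admissible r
Admissible-suffix p {r} = Admissible-factor (p , [] , cong (p ++_) (++-identityʳ r))

-- Each 0 of an admissible word begins one of the blocks 012 = φ(0), 02 = φ(1), 021 = φ(12), 0121 = φ(02).
parse-0∷ : ∀ r → Admissible (L0 ∷ r) → ∃₂ λ t β → L0 ∷ r ≡ φ t ++ β × length β ≤ 2
parse-0∷ []                          _   = [] , L0 ∷ [] , refl , s≤s z≤n
parse-0∷ (L0 ∷ r)                    adm = ⊥-elim (square-free adm L0 [] ([] , r , refl))
parse-0∷ (L1 ∷ [])                   _   = [] , L0 ∷ L1 ∷ [] , refl , s≤s (s≤s z≤n)
parse-0∷ (L1 ∷ L0 ∷ r)               adm = ⊥-elim (no-010 adm ([] , r , refl))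
parse-0∷ (L1 ∷ L1 ∷ r)               adm = ⊥-elim (square-free adm L1 [] (L0 ∷ [] , r , refl))
parse-0∷ (L1 ∷ L2 ∷ [])              _   = L0 ∷ [] , [] , refl , z≤n
parse-0∷ (L1 ∷ L2 ∷ L2 ∷ r)          adm = ⊥-elim (square-free adm L2 [] (L0 ∷ L1 ∷ [] , r , refl))
parse-0∷ (L1 ∷ L2 ∷ L1 ∷ [])         _   = L0 ∷ [] , L1 ∷ [] , refl , s≤s z≤n
parse-0∷ (L1 ∷ L2 ∷ L1 ∷ L1 ∷ r)     adm = ⊥-elim (square-free adm L1 [] (L0 ∷ L1 ∷ L2 ∷ [] , r , refl))
parse-0∷ (L1 ∷ L2 ∷ L1 ∷ L2 ∷ r)     adm = ⊥-elim (square-free adm L1 (L2 ∷ []) (L0 ∷ [] , r , refl))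
parse-0∷ (L1 ∷ L2 ∷ L1 ∷ L0 ∷ r)     adm with parse-0∷ r (Admissible-suffix (L0 ∷ L1 ∷ L2 ∷ L1 ∷ []) adm)
... | t , β , eq , β≤2 = L0 ∷ L2 ∷ t , β , cong (λ r′ → L0 ∷ L1 ∷ L2 ∷ L1 ∷ r′) eq , β≤2
parse-0∷ (L1 ∷ L2 ∷ L0 ∷ r)          adm with parse-0∷ r (Admissible-suffix (L0 ∷ L1 ∷ L2 ∷ []) adm)
... | t , β , eq , β≤2 = L0 ∷ t , β , cong (λ r′ → L0 ∷ L1 ∷ L2 ∷ r′) eq , β≤2
parse-0∷ (L2 ∷ [])                   _   = L1 ∷ [] , [] , refl , z≤n
parse-0∷ (L2 ∷ L2 ∷ r)               adm = ⊥-elim (square-free adm L2 [] (L0 ∷ [] , r , refl))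
parse-0∷ (L2 ∷ L0 ∷ r)               adm with parse-0∷ r (Admissible-suffix (L0 ∷ L2 ∷ []) adm)
... | t , β , eq , β≤2 = L1 ∷ t , β , cong (λ r′ → L0 ∷ L2 ∷ r′) eq , β≤2
parse-0∷ (L2 ∷ L1 ∷ [])              _   = L1 ∷ L2 ∷ [] , [] , refl , z≤n
parse-0∷ (L2 ∷ L1 ∷ L1 ∷ r)          adm = ⊥-elim (square-free adm L1 [] (L0 ∷ L2 ∷ [] , r , refl))
parse-0∷ (L2 ∷ L1 ∷ L2 ∷ r)          adm = ⊥-elim (no-212 adm (L0 ∷ [] , r , refl))
parse-0∷ (L2 ∷ L1 ∷ L0 ∷ r)          adm with parse-0∷ r (Admissible-suffix (L0 ∷ L2 ∷ L1 ∷ []) adm)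
... | t , β , eq , β≤2 = L1 ∷ L2 ∷ t , β , cong (λ r′ → L0 ∷ L2 ∷ L1 ∷ r′) eq , β≤2

¬square-free-nonzero⁴ : ∀ (c d e f : Fin 2) r → ¬ SquareFree (suc c ∷ suc d ∷ suc e ∷ suc f ∷ r)
¬square-free-nonzero⁴ zero       zero       _          _          _ sf = sf L1 [] ([] , _ , refl)
¬square-free-nonzero⁴ (suc zero) (suc zero) _          _          _ sf = sf L2 [] ([] , _ , refl)
¬square-free-nonzero⁴ _          zero       zero       _          _ sf = sf L1 [] (_ ∷ [] , _ , refl)
¬square-free-nonzero⁴ _          (suc zero) (suc zero) _          _ sf = sf L2 [] (_ ∷ [] , _ , refl)
¬square-free-nonzero⁴ _          _          zero       zero       _ sf = sf L1 [] (_ ∷ _ ∷ [] , _ , refl)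
¬square-free-nonzero⁴ _          _          (suc zero) (suc zero) _ sf = sf L2 [] (_ ∷ _ ∷ [] , _ , refl)
¬square-free-nonzero⁴ zero       (suc zero) zero       (suc zero) _ sf = sf L1 (L2 ∷ []) ([] , _ , refl)
¬square-free-nonzero⁴ (suc zero) zero       (suc zero) zero       _ sf = sf L2 (L1 ∷ []) ([] , _ , refl)

split-at-first-0 : ∀ z → Admissible z →
                   ∃ λ α → length α ≤ 3 × (z ≡ α ⊎ ∃ λ r → z ≡ α ++ L0 ∷ r)
split-at-first-0 []                    _   = [] , z≤n , inj₁ refl
split-at-first-0 (L0 ∷ r)              _   = [] , z≤n , inj₂ (r , refl)
split-at-first-0 (c ∷ [])              _   = c ∷ [] , s≤s z≤n , inj₁ refl
split-at-first-0 (c ∷ L0 ∷ r)          _   = c ∷ [] , s≤s z≤n , inj₂ (r , refl)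
split-at-first-0 (c ∷ d ∷ [])          _   = c ∷ d ∷ [] , s≤s (s≤s z≤n) , inj₁ refl
split-at-first-0 (c ∷ d ∷ L0 ∷ r)      _   = c ∷ d ∷ [] , s≤s (s≤s z≤n) , inj₂ (r , refl)
split-at-first-0 (c ∷ d ∷ e ∷ [])      _   = c ∷ d ∷ e ∷ [] , s≤s (s≤s (s≤s z≤n)) , inj₁ refl
split-at-first-0 (c ∷ d ∷ e ∷ L0 ∷ r)  _   = c ∷ d ∷ e ∷ [] , s≤s (s≤s (s≤s z≤n)) , inj₂ (r , refl)
split-at-first-0 (suc c ∷ suc d ∷ suc e ∷ suc f ∷ r) adm =
  ⊥-elim (¬square-free-nonzero⁴ c d e f r (square-free adm))

length-φ3 : ∀ c → length (φ3 c) ≤ 3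
length-φ3 L0 = ≤-refl
length-φ3 L1 = s≤s (s≤s z≤n)
length-φ3 L2 = s≤s z≤n

length-φ≤ : ∀ x → length (φ x) ≤ 3 * length x
length-φ≤ []      = z≤n
length-φ≤ (c ∷ x) = begin
  length (φ3 c ++ φ x)          ≡⟨ length-++ (φ3 c) ⟩
  length (φ3 c) + length (φ x)  ≤⟨ +-mono-≤ (length-φ3 c) (length-φ≤ x) ⟩
  3 + 3 * length x              ≡⟨ *-suc 3 (length x) ⟨
  3 * suc (length x)            ∎
  where open ≤-Reasoning

length-≤φ : ∀ x → length x ≤ length (φ x)
length-≤φ []       = z≤n
length-≤φ (L0 ∷ x) = s≤s (m≤n⇒m≤o+n 2 (length-≤φ x))
length-≤φ (L1 ∷ x) = s≤s (m≤n⇒m≤o+n 1 (length-≤φ x))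
length-≤φ (L2 ∷ x) = s≤s (length-≤φ x)

length-φ^≤ : ∀ n x → length (φ^ n x) ≤ 3 ^ n * length x
length-φ^≤ zero    x = ≤-reflexive (sym (+-identityʳ (length x)))
length-φ^≤ (suc n) x = begin
  length (φ (φ^ n x))        ≤⟨ length-φ≤ (φ^ n x) ⟩
  3 * length (φ^ n x)        ≤⟨ *-monoʳ-≤ 3 (length-φ^≤ n x) ⟩
  3 * (3 ^ n * length x)     ≡⟨ *-assoc 3 (3 ^ n) (length x) ⟨
  3 ^ suc n * length x       ∎
  where open ≤-Reasoning

record Desubstitution (n b : ℕ) (z : Word 3) : Set where
  constructor desubst
  field
    prefix core suffix : Word 3
    decomposition      : z ≡ prefix ++ φ^ n core ++ suffix
    core-admissible    : Admissible core
    prefix-bound       : length prefix ≤ b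
    suffix-bound       : length suffix ≤ b

desubstitute : ∀ z → Admissible z → Desubstitution 1 6 z
desubstitute z adm with split-at-first-0 z adm
... | α , α≤3 , inj₁ refl =
  desubst α [] [] (sym (++-identityʳ α)) Admissible-[] (m≤n⇒m≤o+n 3 α≤3) z≤n
... | α , α≤3 , inj₂ (r , refl) with parse-0∷ r (Admissible-suffix α adm)
...   | [] , β , eq , β≤2 =
  desubst α [] β (cong (α ++_) eq) Admissible-[] (m≤n⇒m≤o+n 3 α≤3) (m≤n⇒m≤o+n 4 β≤2)
...   | c ∷ t₁ , β , eq , β≤2 with initLast t₁
...     | [] =
  desubst α [] (φ (c ∷ []) ++ β) (cong (α ++_) eq) Admissible-[] (m≤n⇒m≤o+n 3 α≤3)
    (m≤n⇒m≤1+n (length-++-≤ (φ (c ∷ [])) (length-φ≤ (c ∷ [])) β≤2))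
...     | t ∷ʳ′ d =
  desubst (α ++ φ3 c) t (φ3 d ++ β) decomposition
    (Admissible-φ⁻¹ c t d (Admissible-factor (α , β , sym (cong (α ++_) eq)) adm))
    (length-++-≤ α α≤3 (length-φ3 c))
    (m≤n⇒m≤1+n (length-++-≤ (φ3 d) (length-φ3 d) β≤2))
  where
  open ≡-Reasoning
  decomposition : α ++ L0 ∷ r ≡ (α ++ φ3 c) ++ φ t ++ φ3 d ++ β
  decomposition = begin
    α ++ L0 ∷ r                                  ≡⟨ cong (α ++_) eq ⟩
    α ++ (φ3 c ++ φ (t ++ [ d ])) ++ β           ≡⟨ cong (λ v → α ++ (φ3 c ++ v) ++ β) (φ-++ t [ d ]) ⟩
    α ++ (φ3 c ++ φ t ++ φ3 d ++ []) ++ β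
      ≡⟨ solve 5 (λ α c t d β → α ⊕ (c ⊕ t ⊕ d ⊕ id) ⊕ β ⊜ (α ⊕ c) ⊕ t ⊕ d ⊕ β) refl α (φ3 c) (φ t) (φ3 d) β ⟩
    (α ++ φ3 c) ++ φ t ++ φ3 d ++ β              ∎

margin : ℕ → ℕ
margin zero    = 0
margin (suc n) = 6 + 3 * margin n

desubstitute^ : ∀ n z → Admissible z → Desubstitution n (margin n) z
desubstitute^ zero    z adm = desubst [] z [] (sym (++-identityʳ z)) adm z≤n z≤n
desubstitute^ (suc n) z adm with desubstitute z adm
... | desubst α₁ t₁ β₁ refl adm₁ α₁≤6 β₁≤6 with desubstitute^ n t₁ adm₁
...   | desubst α t β refl adm′ α≤m β≤m =
  desubst (α₁ ++ φ α) t (φ β ++ β₁) decomposition adm′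
    (length-++-≤ α₁ α₁≤6 (φ-bound α α≤m))
    (≤-trans (length-++-≤ (φ β) (φ-bound β β≤m) β₁≤6) (≤-reflexive (+-comm (3 * margin n) 6)))
  where
  φ-bound : ∀ x → length x ≤ margin n → length (φ x) ≤ 3 * margin n
  φ-bound x x≤m = ≤-trans (length-φ≤ x) (*-monoʳ-≤ 3 x≤m)
  open ≡-Reasoning
  decomposition : α₁ ++ φ (α ++ φ^ n t ++ β) ++ β₁ ≡ (α₁ ++ φ α) ++ φ^ (suc n) t ++ φ β ++ β₁
  decomposition = begin
    α₁ ++ φ (α ++ φ^ n t ++ β) ++ β₁                 ≡⟨ cong (λ v → α₁ ++ v ++ β₁) (φ-++ α _) ⟩
    α₁ ++ (φ α ++ φ (φ^ n t ++ β)) ++ β₁             ≡⟨ cong (λ v → α₁ ++ (φ α ++ v) ++ β₁) (φ-++ (φ^ n t) β) ⟩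
    α₁ ++ (φ α ++ φ^ (suc n) t ++ φ β) ++ β₁
      ≡⟨ solve 5 (λ a₁ a m b b₁ → a₁ ⊕ (a ⊕ m ⊕ b) ⊕ b₁ ⊜ (a₁ ⊕ a) ⊕ m ⊕ b ⊕ b₁)
                 refl α₁ (φ α) (φ^ (suc n) t) (φ β) β₁ ⟩
    (α₁ ++ φ α) ++ φ^ (suc n) t ++ φ β ++ β₁         ∎

φ^-[] : ∀ n → φ^ n [] ≡ []
φ^-[] zero    = refl
φ^-[] (suc n) = cong φ (φ^-[] n)

φ^-++ : ∀ n u v → φ^ n (u ++ v) ≡ φ^ n u ++ φ^ n v
φ^-++ zero    u v = refl
φ^-++ (suc n) u v = trans (cong φ (φ^-++ n u v)) (φ-++ (φ^ n u) (φ^ n v))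

φ^-+ : ∀ m n t → φ^ (m + n) t ≡ φ^ m (φ^ n t)
φ^-+ zero    n t = refl
φ^-+ (suc m) n t = cong φ (φ^-+ m n t)

φ^-concatMap : ∀ n t → φ^ n t ≡ concatMap (λ c → φ^ n [ c ]) t
φ^-concatMap n []      = φ^-[] n
φ^-concatMap n (c ∷ t) = trans (φ^-++ n [ c ] t) (cong (φ^ n [ c ] ++_) (φ^-concatMap n t))

FinFactor-φ^ : ∀ n {u v} → FinFactor u v → FinFactor (φ^ n u) (φ^ n v)
FinFactor-φ^ zero    F = F
FinFactor-φ^ (suc n) F = FinFactor-concatMap φ3 (FinFactor-φ^ n F)

b3prefix≡φ^ : ∀ n → b3prefix n ≡ φ^ n [ L0 ]
b3prefix≡φ^ zero    = refl
b3prefix≡φ^ (suc n) = cong φ (b3prefix≡φ^ n)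

contains-0 : ∀ t → Admissible t → 4 ≤ length t → FinFactor [ L0 ] t
contains-0 t adm 4≤t with split-at-first-0 t adm
... | α , α≤3 , inj₁ refl = ⊥-elim (<⇒≱ (s≤s α≤3) 4≤t)
... | α , _   , inj₂ (r , eq) = α , r , sym eq

φ^[0]-factor-of-long : ∀ n z → Admissible z → margin n + 3 ^ n * 3 + margin n < length z →
                       FinFactor (φ^ n [ L0 ]) z
φ^[0]-factor-of-long n z adm long with desubstitute^ n z adm
... | desubst α t β refl adm-t α≤m β≤m with 4 ≤? length t
...   | yes 4≤t = FinFactor-trans (FinFactor-φ^ n (contains-0 t adm-t 4≤t)) (α , β , refl)
...   | no  4≰t = ⊥-elim (<⇒≱ long (begin
  length (α ++ φ^ n t ++ β)                   ≤⟨ length-++-≤ α α≤m (length-++-≤ (φ^ n t) φ^nt≤ β≤m) ⟩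
  margin n + (3 ^ n * 3 + margin n)           ≡⟨ +-assoc (margin n) _ _ ⟨
  margin n + 3 ^ n * 3 + margin n             ∎))
  where
  open ≤-Reasoning
  φ^nt≤ : length (φ^ n t) ≤ 3 ^ n * 3
  φ^nt≤ = ≤-trans (length-φ^≤ n t) (*-monoʳ-≤ (3 ^ n) (≤-pred (≰⇒> 4≰t)))

length-φφ : ∀ c x → 2 + length x ≤ length (φ (φ (c ∷ x)))
length-φφ c x = begin
  2 + length x                            ≤⟨ +-mono-≤ (2≤φφ c) (≤-trans (length-≤φ x) (length-≤φ (φ x))) ⟩
  length (φ (φ3 c)) + length (φ (φ x))    ≡⟨ length-++ (φ (φ3 c)) ⟨
  length (φ (φ3 c) ++ φ (φ x))            ≡⟨ cong length (φ-++ (φ3 c) (φ x)) ⟨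
  length (φ (φ (c ∷ x)))                  ∎
  where
  open ≤-Reasoning
  2≤φφ : ∀ c → 2 ≤ length (φ (φ3 c))
  2≤φφ L0 = s≤s (s≤s z≤n)
  2≤φφ L1 = s≤s (s≤s z≤n)
  2≤φφ L2 = s≤s (s≤s z≤n)

length-φ^-letter : ∀ n c → n < length (φ^ (n * 2) [ c ])
length-φ^-letter zero    c = s≤s z≤n
length-φ^-letter (suc n) c with φ^ (n * 2) [ c ] | length-φ^-letter n c
... | c′ ∷ x | n<cx = ≤-trans (s≤s n<cx) (length-φφ c′ x)

short-admissible-factor : ∀ x → length x ≤ 2 → Admissible x → FinFactor x (φ^ 3 [ L0 ])
short-admissible-factor []              _ _   = [] , _ , refl
short-admissible-factor (L0 ∷ [])       _ _   = [] , _ , refl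
short-admissible-factor (L1 ∷ [])       _ _   = L0 ∷ [] , _ , refl
short-admissible-factor (L2 ∷ [])       _ _   = L0 ∷ L1 ∷ [] , _ , refl
short-admissible-factor (L0 ∷ L1 ∷ [])  _ _   = [] , _ , refl
short-admissible-factor (L0 ∷ L2 ∷ [])  _ _   = L0 ∷ L1 ∷ L2 ∷ [] , _ , refl
short-admissible-factor (L1 ∷ L0 ∷ [])  _ _   = L0 ∷ L1 ∷ L2 ∷ L0 ∷ L2 ∷ [] , _ , refl
short-admissible-factor (L1 ∷ L2 ∷ [])  _ _   = L0 ∷ [] , _ , refl
short-admissible-factor (L2 ∷ L0 ∷ [])  _ _   = L0 ∷ L1 ∷ [] , _ , refl
short-admissible-factor (L2 ∷ L1 ∷ [])  _ _   = L0 ∷ L1 ∷ L2 ∷ L0 ∷ [] , _ , refl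
short-admissible-factor (L0 ∷ L0 ∷ [])  _ adm = ⊥-elim (square-free adm L0 [] ([] , [] , refl))
short-admissible-factor (L1 ∷ L1 ∷ [])  _ adm = ⊥-elim (square-free adm L1 [] ([] , [] , refl))
short-admissible-factor (L2 ∷ L2 ∷ [])  _ adm = ⊥-elim (square-free adm L2 [] ([] , [] , refl))
short-admissible-factor (_ ∷ _ ∷ _ ∷ _) (s≤s (s≤s ())) _

deep-factor-of-φ^[0] : ∀ N p u q → Admissible (p ++ u ++ q) → (∀ c → length u ≤ length (φ^ N [ c ])) →
                       margin N ≤ length p → margin N ≤ length q → FinFactor u (φ^ (N + 3) [ L0 ])
deep-factor-of-φ^[0] N p u q adm images-long p-long q-long with desubstitute^ N (p ++ u ++ q) adm
... | desubst α t β eq adm-t α≤m β≤m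
  with factor-within-two-images (λ c → φ^ N [ c ]) images-long t
         (subst (FinFactor u) (φ^-concatMap N t)
           (FinFactor-inner p u q α (φ^ N t) β eq (≤-trans α≤m p-long) (≤-trans β≤m q-long)))
... | x , x≤2 , x∈t , u∈φ^x =
  FinFactor-trans (subst (FinFactor u) (sym (φ^-concatMap N x)) u∈φ^x)
    (subst (FinFactor (φ^ N x)) (sym (φ^-+ N 3 [ L0 ]))
      (FinFactor-φ^ N (short-admissible-factor x x≤2 (Admissible-factor x∈t adm-t))))

AllFactorsAdmissible : BiWord 3 → Set
AllFactorsAdmissible s = ∀ {u} → BiFactor s u → Admissible u

module _ {s : BiWord 3} (adm : AllFactorsAdmissible s) where

  BiFactor⇒factor-of-b3 : ∀ {u} → BiFactor s u → ∃ λ K → FinFactor u (b3prefix K)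
  BiFactor⇒factor-of-b3 {u} F with BiFactor-bordered s F (margin (length u * 2))
  ... | p , q , |p|≡m , |q|≡m , F′ =
    length u * 2 + 3 ,
    subst (FinFactor u) (sym (b3prefix≡φ^ (length u * 2 + 3)))
      (deep-factor-of-φ^[0] (length u * 2) p u q (adm F′) (λ c → <⇒≤ (length-φ^-letter (length u) c))
        (≤-reflexive (sym |p|≡m)) (≤-reflexive (sym |q|≡m)))

  b3prefix-occurs : ∀ n → BiFactor s (b3prefix n)
  b3prefix-occurs n =
    FinFactor-BiFactor s (subst (λ v → FinFactor v z) (sym (b3prefix≡φ^ n)) φ^[0]∈z)
      (+ 0 , OccursAt-window s (+ 0) L)
    where
    L = suc (margin n + 3 ^ n * 3 + margin n)
    z = window s (+ 0) L
    φ^[0]∈z : FinFactor (φ^ n [ L0 ]) z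
    φ^[0]∈z = φ^[0]-factor-of-long n z (adm (+ 0 , OccursAt-window s (+ 0) L))
                (≤-reflexive (sym (length-window s (+ 0) L)))

module Concatenation {k : ℕ} (w : BiWord k) (m : Morphism3 k) (s : BiWord 3) (pos : ℤ → ℤ)
  (pos-suc : ∀ i → pos (ℤ.suc i) ≡ pos i ℤ.+ + length (m (s i)))
  (occ : ∀ i → OccursAt w (pos i) (m (s i)))
  (m-nonempty : ∀ c → ∃ λ n → length (m c) ≡ suc n) where

  OccursAt-applyM : ∀ j X → OccursAt s j X → OccursAt w (pos j) (applyM m X)
  OccursAt-applyM j []      _          = tt
  OccursAt-applyM j (c ∷ X) (refl , o) =
    OccursAt-++ w (pos j) (m (s j)) (applyM m X) (occ j)
      (subst (λ z → OccursAt w z (applyM m X)) (pos-suc j) (OccursAt-applyM (ℤ.suc j) X o))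

  BiFactor-applyM : ∀ {X} → BiFactor s X → BiFactor w (applyM m X)
  BiFactor-applyM {X} (j , o) = pos j , OccursAt-applyM j X o

  length-≤applyM : ∀ X → length X ≤ length (applyM m X)
  length-≤applyM []      = z≤n
  length-≤applyM (c ∷ X) with m-nonempty c
  ... | n , |mc|≡1+n = begin
    suc (length X)                         ≤⟨ s≤s (m≤n⇒m≤o+n n (length-≤applyM X)) ⟩
    suc n + length (applyM m X)            ≡⟨ cong (_+ length (applyM m X)) |mc|≡1+n ⟨
    length (m c) + length (applyM m X)     ≡⟨ length-++ (m c) ⟨
    length (m c ++ applyM m X)             ∎
    where open ≤-Reasoning

  Covered : ℤ → Set
  Covered z = ∃₂ λ i d → z ≡ pos i ℤ.+ + d

  Covered-pred : ∀ {z} → Covered z → Covered (ℤ.pred z)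
  Covered-pred (i , suc d , refl) = i , d , pred[i+suc[n]]≡i+n (pos i) d
  Covered-pred (i , zero , refl) with m-nonempty (s (ℤ.pred i))
  ... | n , |m|≡1+n = ℤ.pred i , n , (begin
    ℤ.pred (pos i ℤ.+ + 0)                                   ≡⟨ cong ℤ.pred (ℤ.+-identityʳ (pos i)) ⟩
    ℤ.pred (pos i)                                           ≡⟨ cong (ℤ.pred ∘ pos) (ℤ.suc-pred i) ⟨
    ℤ.pred (pos (ℤ.suc (ℤ.pred i)))                          ≡⟨ cong ℤ.pred (pos-suc (ℤ.pred i)) ⟩
    ℤ.pred (pos (ℤ.pred i) ℤ.+ + length (m (s (ℤ.pred i))))  ≡⟨ cong (λ l → ℤ.pred (pos (ℤ.pred i) ℤ.+ + l)) |m|≡1+n ⟩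
    ℤ.pred (pos (ℤ.pred i) ℤ.+ + suc n)                      ≡⟨ pred[i+suc[n]]≡i+n (pos (ℤ.pred i)) n ⟩
    pos (ℤ.pred i) ℤ.+ + n                                   ∎)
    where open ≡-Reasoning

  Covered-below : ∀ n → Covered (pos (+ 0) ℤ.- + n)
  Covered-below zero    = + 0 , 0 , refl
  Covered-below (suc n) = subst Covered (sym (ℤ.minus-suc (pos (+ 0)) n)) (Covered-pred (Covered-below n))

  covered : ∀ z → Covered z
  covered z with z ℤ.- pos (+ 0) | i≡j+[i-j] z (pos (+ 0))
  ... | + d      | eq = + 0 , d , eq
  ... | -[1+ n ] | eq = subst Covered (sym eq) (Covered-below (suc n))

  factor-preimage : ∀ {v} → BiFactor w v → ∃ λ X → BiFactor s X × FinFactor v (applyM m X)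
  factor-preimage {v} (z , ov) with covered z
  ... | i , d , refl =
    X , (i , OccursAt-window s i L) ,
    OccursAt-within w (pos i) d (applyM m X) v (OccursAt-applyM i X (OccursAt-window s i L)) ov
      (≤-trans (≤-reflexive (sym (length-window s i L))) (length-≤applyM X))
    where
    L = d + length v
    X = window s i L

module Coding {k : ℕ} (w : BiWord k) (m : Morphism3 k) (s : BiWord 3) (pos : ℤ → ℤ)
  (pos-suc : ∀ i → pos (ℤ.suc i) ≡ pos i ℤ.+ + length (m (s i)))
  (occ : ∀ i → OccursAt w (pos i) (m (s i)))
  (a b : Fin k) (x y : Word k)
  (m0 : m L0 ≡ a ∷ b ∷ x ++ [ b ]) (m1 : m L1 ≡ a ∷ b ∷ []) (m2 : m L2 ≡ a ∷ y)
  (overlap-free : OverlapFree w) where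

  m-starts-with-a : ∀ c → ∃ λ r → m c ≡ a ∷ r
  m-starts-with-a L0 = _ , m0
  m-starts-with-a L1 = _ , m1
  m-starts-with-a L2 = _ , m2

  m-nonempty : ∀ c → ∃ λ n → length (m c) ≡ suc n
  m-nonempty c with m-starts-with-a c
  ... | r , eq = length r , cong length eq

  open Concatenation w m s pos pos-suc occ m-nonempty public

  applyM-starts-with-a : ∀ c u → ∃ λ R → applyM m (c ∷ u) ≡ a ∷ R
  applyM-starts-with-a c u with m-starts-with-a c
  ... | r , eq = r ++ applyM m u , cong (_++ applyM m u) eq

  square-free-preimage : ∀ {X} → BiFactor s X → SquareFree X
  square-free-preimage F c u sq with BiFactor-∷ʳ s (FinFactor-BiFactor s sq F)
  ... | d , F′ with applyM-starts-with-a c u | applyM-starts-with-a d []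
  ... | R , eqR | r , eqr = overlap-free a R (FinFactor-BiFactor w aRaRa∈image (BiFactor-applyM F′))
    where
    U = c ∷ u
    open ≡-Reasoning
    image : applyM m ((U ++ U) ++ [ d ]) ≡ ((a ∷ R) ++ (a ∷ R)) ++ a ∷ r
    image = begin
      applyM m ((U ++ U) ++ [ d ])                 ≡⟨ concatMap-++ m (U ++ U) [ d ] ⟩
      applyM m (U ++ U) ++ applyM m [ d ]          ≡⟨ cong (_++ applyM m [ d ]) (concatMap-++ m U U) ⟩
      (applyM m U ++ applyM m U) ++ applyM m [ d ] ≡⟨ cong₂ (λ V W → (V ++ V) ++ W) eqR eqr ⟩
      ((a ∷ R) ++ (a ∷ R)) ++ a ∷ r                ∎
    aRaRa∈image : FinFactor (a ∷ R ++ a ∷ R ++ [ a ]) (applyM m ((U ++ U) ++ [ d ]))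
    aRaRa∈image =
      [] , r ,
      trans (solve 3 (λ A R r → (A ⊕ R ⊕ A ⊕ R ⊕ A) ⊕ r ⊜ ((A ⊕ R) ⊕ (A ⊕ R)) ⊕ A ⊕ r) refl [ a ] R r) (sym image)

  image-010 : FinFactor (b ∷ a ∷ b ∷ a ∷ b ∷ []) (m L0 ++ m L1 ++ m L0 ++ [])
  image-010 rewrite m0 | m1 =
    a ∷ b ∷ x , x ++ [ b ] ++ [] ,
    solve 3 (λ A B x → (A ⊕ B ⊕ x) ⊕ (B ⊕ A ⊕ B ⊕ A ⊕ B) ⊕ (x ⊕ B ⊕ id)
                       ⊜ (A ⊕ B ⊕ x ⊕ B) ⊕ (A ⊕ B) ⊕ (A ⊕ B ⊕ x ⊕ B) ⊕ id) refl [ a ] [ b ] x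

  image-02120 : FinFactor (b ∷ (a ∷ y ++ [ a ]) ++ b ∷ (a ∷ y ++ [ a ]) ++ [ b ])
                          (m L0 ++ m L2 ++ m L1 ++ m L2 ++ m L0 ++ [])
  image-02120 rewrite m0 | m1 | m2 =
    a ∷ b ∷ x , x ++ [ b ] ++ [] ,
    solve 4 (λ A B x y → (A ⊕ B ⊕ x) ⊕ (B ⊕ (A ⊕ y ⊕ A) ⊕ B ⊕ (A ⊕ y ⊕ A) ⊕ B) ⊕ (x ⊕ B ⊕ id)
                         ⊜ (A ⊕ B ⊕ x ⊕ B) ⊕ (A ⊕ y) ⊕ (A ⊕ B) ⊕ (A ⊕ y) ⊕ (A ⊕ B ⊕ x ⊕ B) ⊕ id)
      refl [ a ] [ b ] x y

  ¬BiFactor-212 : ¬ BiFactor s (L2 ∷ L1 ∷ L2 ∷ [])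
  ¬BiFactor-212 F with BiFactor-∷ s F
  ... | L1 , F′ = square-free-preimage F′ L1 [ L2 ] ([] , [] , refl)
  ... | L2 , F′ = square-free-preimage F′ L2 [] ([] , _ , refl)
  ... | L0 , F′ with BiFactor-∷ʳ s F′
  ...   | L1 , F″ = square-free-preimage F″ L2 [ L1 ] (L0 ∷ [] , [] , refl)
  ...   | L2 , F″ = square-free-preimage F″ L2 [] (L0 ∷ L2 ∷ L1 ∷ [] , [] , refl)
  ...   | L0 , F″ = overlap-free b (a ∷ y ++ [ a ]) (FinFactor-BiFactor w image-02120 (BiFactor-applyM F″))

  admissible-preimage : AllFactorsAdmissible s
  admissible-preimage F = record
    { square-free = square-free-preimage F
    ; no-010      = λ F₀₁₀ → overlap-free b [ a ]
                      (FinFactor-BiFactor w image-010 (BiFactor-applyM (FinFactor-BiFactor s F₀₁₀ F)))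
    ; no-212      = λ F₂₁₂ → ¬BiFactor-212 (FinFactor-BiFactor s F₂₁₂ F)
    }

lemma6 : (k : ℕ) → 1 ≤ k → (w : BiWord k) → (m : Morphism3 k) →
    BiConcat w m →
    (Σ (Fin k) λ a → Σ (Fin k) λ b → Σ (Word k) λ x → Σ (Word k) λ y →
      (m zero ≡ a ∷ b ∷ x ++ [ b ]) × (m (suc zero) ≡ a ∷ b ∷ []) × (m (suc (suc zero)) ≡ a ∷ y)) →
    OverlapFree w →
    (v : Word k) → BiFactor w v ⇔ FactorOfMb3 m v
-- k ≥ 1 is implied by the letter a.
lemma6 k _ w m (s , pos , pos-suc , occ) (a , b , x , y , m0 , m1 , m2) overlap-free v = mk⇔ to from
  where
  open Coding w m s pos pos-suc occ a b x y m0 m1 m2 overlap-free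

  to : BiFactor w v → FactorOfMb3 m v
  to F with factor-preimage F
  ... | X , X∈s , v∈mX with BiFactor⇒factor-of-b3 admissible-preimage X∈s
  ... | K , X∈b3 = K , FinFactor-trans v∈mX (FinFactor-concatMap m X∈b3)

  from : FactorOfMb3 m v → BiFactor w v
  from (n , v∈mb3) = FinFactor-BiFactor w v∈mb3 (BiFactor-applyM (b3prefix-occurs admissible-preimage n))
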